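{- $\vdash_{\mathsf{GT}} \Gamma \Rightarrow \Delta$ implies $\Gamma\models\bigvee\Delta$.
   Context: Classical formulas (of $\mathbf{CPL}$) are generated by $\alpha::=p\mid\bot\mid\neg\alpha\mid\alpha\wedge\alpha\mid\alpha\vee\alpha$ ($p$ a propositional variable). Formulas of basic propositional team logic $\mathbf{PL}(\mathbin{\backslash\!\!\!/})$ are generated by $\phi::=\alpha\mid\phi\wedge\phi\mid\phi\vee\phi\mid\phi\mathbin{\backslash\!\!\!/}\phi$ with $\alpha$ classical; $\vee$ is the split disjunction and $\mathbin{\backslash\!\!\!/}$ the inquisitive disjunction. Below $\alpha$ ranges over classical formulas and $\Lambda$ over finite multisets of classical formulas. A team is a set $t$ of valuations; $t\models p$ iff $v(p)=1$ for all $v\in t$; $t\models\bot$ iff $t=\emptyset$; $t\models\neg\alpha$ iff $\{v\}\not\models\alpha$ for all $v\in t$; $t\models\phi\wedge\psi$ iff $t\models\phi$ and $t\models\psi$; $t\models\phi\vee\psi$ iff $t=s\cup u$ for some $s\models\phi$, $u\models\psi$; $t\models\phi\mathbin{\backslash\!\!\!/}\psi$ iff $t\models\phi$ or $t\models\psi$. $\Gamma\models\phi$ iff every team satisfying all formulas of $\Gamma$ satisfies $\phi$; $\bigvee\emptyset:=\bot$. A sequent $\Gamma\Rightarrow\Delta$ (finite multisets) is valid iff $\Gamma\models\bigvee\Delta$. The calculus $\mathsf{GT}$ has axioms $\Gamma,p\Rightarrow p,\Delta$ and $\Gamma,\bot\Rightarrow\Delta$ and rules: ($\mathsf{L}\neg$)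 from $\Gamma\Rightarrow\alpha,\Delta$ infer $\Gamma,\neg\alpha\Rightarrow\Delta$; ($\mathsf{R}\neg$) from $\Gamma,\alpha\Rightarrow\Delta$ infer $\Gamma\Rightarrow\neg\alpha,\Delta$; ($\mathsf{L}\wedge$) from $\Gamma,\phi,\psi\Rightarrow\Delta$ infer $\Gamma,\phi\wedge\psi\Rightarrow\Delta$; ($\mathsf{R}\wedge$) from $\Gamma\Rightarrow\phi,\Lambda$ and $\Gamma\Rightarrow\psi,\Lambda$ infer $\Gamma\Rightarrow\phi\wedge\psi,\Lambda,\Delta$; ($\mathsf{L}\vee$) from $\Gamma,\phi\Rightarrow\Lambda$ and $\Gamma,\psi\Rightarrow\Lambda$ infer $\Gamma,\phi\vee\psi\Rightarrow\Lambda,\Delta$; ($\mathsf{R}\vee$) from $\Gamma\Rightarrow\phi,\psi,\Delta$ infer $\Gamma\Rightarrow\phi\vee\psi,\Delta$; ($\mathsf{L}\mathbin{\backslash\!\!\!/}$) from $\Gamma,\chi\{\phi_L\}\Rightarrow\Delta$ and $\Gamma,\chi\{\phi_R\}\Rightarrow\Delta$ infer $\Gamma,\chi\{\phi_L\mathbin{\backslash\!\!\!/}\phi_R\}\Rightarrow\Delta$; ($\mathsf{R}\mathbin{\backslash\!\!\!/}$) from $\Gamma\Rightarrow\chi\{\phi_i\},\Delta$ ($i\in\{L,R\}$) infer $\Gamma\Rightarrow\chi\{\phi_L\mathbin{\backslash\!\!\!/}\phi_R\},\Delta$; ($\mathsf{Cut}$) from $\Gamma\Rightarrow\phi,\Delta$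 and $\Pi,\phi\Rightarrow\Sigma$ infer $\Pi,\Gamma\Rightarrow\Delta,\Sigma$. Here $\chi\{\eta\}$ denotes the result of replacing one fixed occurrence of a subformula of $\chi$, not in the scope of a negation, by $\eta$. -}

module Defs where

open import Data.Nat using (ℕ)
open import Data.Bool using (Bool; true)
open import Data.List using (List; []; _∷_; _++_; map; foldr)
open import Data.List.Membership.Propositional using (_∈_)
open import Data.List.Relation.Binary.Permutation.Propositional using (_↭_)
open import Data.Product using (Σ; _×_)
open import Data.Sum using (_⊎_)
open import Data.Empty using (⊥)
open import Relation.Nullary using (¬_)
open import Relation.Binary.PropositionalEquality using (_≡_)
open import Function.Bundles using (_⇔_)
open import Level using (Lift)

Var : Set
Var = ℕ

data CForm : Set where
  cvar : Var → CForm
  cbot : CForm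
  cneg : CForm → CForm
  cand : CForm → CForm → CForm
  cor  : CForm → CForm → CForm

-- Formulas of PL(⩖):  φ ::= α | φ ∧ φ | φ ∨ φ | φ ⩖ φ.
-- Equivalently (unambiguously): φ ::= p | ⊥ | ¬α | φ ∧ φ | φ ∨ φ | φ ⩖ φ,
-- negation being applied to classical formulas only.
data Form : Set where
  var  : Var → Form
  bot  : Form
  neg  : CForm → Form
  _∧_  : Form → Form → Form
  _∨_  : Form → Form → Form
  _⩖_  : Form → Form → Form

infixr 6 _∧_
infixr 5 _∨_
infixr 4 _⩖_

⌜_⌝ : CForm → Form
⌜ cvar p ⌝   = var p
⌜ cbot ⌝     = bot
⌜ cneg α ⌝   = neg α
⌜ cand α β ⌝ = ⌜ α ⌝ ∧ ⌜ β ⌝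
⌜ cor α β ⌝  = ⌜ α ⌝ ∨ ⌜ β ⌝

⋁ : List Form → Form
⋁ = foldr _∨_ bot

Valuation : Set
Valuation = Var → Bool

Team : Set₁
Team = Valuation → Set

⟦_⟧₁ : Valuation → Team
⟦ v ⟧₁ w = w ≡ v

_≐_∪_ : Team → Team → Team → Set
t ≐ s ∪ u = ∀ v → t v ⇔ (s v ⊎ u v)

_⊨c_ : Team → CForm → Set₁
t ⊨c cvar p   = Lift _ (∀ v → t v → v p ≡ true)
t ⊨c cbot     = Lift _ (∀ v → ¬ t v)
t ⊨c cneg α   = ∀ v → t v → ¬ (⟦ v ⟧₁ ⊨c α)
t ⊨c cand α β = (t ⊨c α) × (t ⊨c β)
t ⊨c cor α β  = Σ Team λ s → Σ Team λ u → (s ⊨c α) × (u ⊨c β) × (t ≐ s ∪ u)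

_⊨_ : Team → Form → Set₁
t ⊨ var p   = Lift _ (∀ v → t v → v p ≡ true)
t ⊨ bot     = Lift _ (∀ v → ¬ t v)
t ⊨ neg α   = ∀ v → t v → ¬ (⟦ v ⟧₁ ⊨c α)
t ⊨ (φ ∧ ψ) = (t ⊨ φ) × (t ⊨ ψ)
t ⊨ (φ ∨ ψ) = Σ Team λ s → Σ Team λ u → (s ⊨ φ) × (u ⊨ ψ) × (t ≐ s ∪ u)
t ⊨ (φ ⩖ ψ) = (t ⊨ φ) ⊎ (t ⊨ ψ)

_⊫_ : List Form → Form → Set₁
Γ ⊫ φ = ∀ (t : Team) → (∀ γ → γ ∈ Γ → t ⊨ γ) → t ⊨ φ

-- One-hole contexts χ{·}: the hole is never in the scope of a negation
-- (negation only applies to classical formulas, which contain no hole).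

data Ctx : Set where
  ∙    : Ctx
  _∧ₗ_ : Ctx → Form → Ctx
  _∧ᵣ_ : Form → Ctx → Ctx
  _∨ₗ_ : Ctx → Form → Ctx
  _∨ᵣ_ : Form → Ctx → Ctx
  _⩖ₗ_ : Ctx → Form → Ctx
  _⩖ᵣ_ : Form → Ctx → Ctx

_⟨_⟩ : Ctx → Form → Form
∙ ⟨ η ⟩        = η
(χ ∧ₗ φ) ⟨ η ⟩ = (χ ⟨ η ⟩) ∧ φ
(φ ∧ᵣ χ) ⟨ η ⟩ = φ ∧ (χ ⟨ η ⟩)
(χ ∨ₗ φ) ⟨ η ⟩ = (χ ⟨ η ⟩) ∨ φ
(φ ∨ᵣ χ) ⟨ η ⟩ = φ ∨ (χ ⟨ η ⟩)
(χ ⩖ₗ φ) ⟨ η ⟩ = (χ ⟨ η ⟩) ⩖ φ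
(φ ⩖ᵣ χ) ⟨ η ⟩ = φ ⩖ (χ ⟨ η ⟩)

-- Sequents Γ ⇒ Δ are pairs of finite multisets,
-- represented as lists; the rule `perm` identifies lists up to
-- permutation (i.e. makes them multisets).  "Γ, φ" is written φ ∷ Γ,
-- and a multiset Λ of classical formulas is written map ⌜_⌝ Λ.

infix 3 ⊢GT_⇒_

data ⊢GT_⇒_ : List Form → List Form → Set where
  perm  : ∀ {Γ Γ′ Δ Δ′} → Γ ↭ Γ′ → Δ ↭ Δ′ →
          ⊢GT Γ ⇒ Δ → ⊢GT Γ′ ⇒ Δ′
  ax    : ∀ {Γ Δ} p → ⊢GT var p ∷ Γ ⇒ var p ∷ Δ
  ax⊥   : ∀ {Γ Δ} → ⊢GT bot ∷ Γ ⇒ Δ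
  L¬    : ∀ {Γ Δ} α → ⊢GT Γ ⇒ ⌜ α ⌝ ∷ Δ → ⊢GT neg α ∷ Γ ⇒ Δ
  R¬    : ∀ {Γ Δ} α → ⊢GT ⌜ α ⌝ ∷ Γ ⇒ Δ → ⊢GT Γ ⇒ neg α ∷ Δ
  L∧    : ∀ {Γ Δ φ ψ} → ⊢GT φ ∷ ψ ∷ Γ ⇒ Δ → ⊢GT (φ ∧ ψ) ∷ Γ ⇒ Δ
  R∧    : ∀ {Γ Δ φ ψ} (Λ : List CForm) →
          ⊢GT Γ ⇒ φ ∷ map ⌜_⌝ Λ → ⊢GT Γ ⇒ ψ ∷ map ⌜_⌝ Λ →
          ⊢GT Γ ⇒ (φ ∧ ψ) ∷ (map ⌜_⌝ Λ ++ Δ)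
  L∨    : ∀ {Γ Δ φ ψ} (Λ : List CForm) →
          ⊢GT φ ∷ Γ ⇒ map ⌜_⌝ Λ → ⊢GT ψ ∷ Γ ⇒ map ⌜_⌝ Λ →
          ⊢GT (φ ∨ ψ) ∷ Γ ⇒ map ⌜_⌝ Λ ++ Δ
  R∨    : ∀ {Γ Δ φ ψ} → ⊢GT Γ ⇒ φ ∷ ψ ∷ Δ → ⊢GT Γ ⇒ (φ ∨ ψ) ∷ Δ
  L⩖    : ∀ {Γ Δ φL φR} (χ : Ctx) →
          ⊢GT (χ ⟨ φL ⟩) ∷ Γ ⇒ Δ → ⊢GT (χ ⟨ φR ⟩) ∷ Γ ⇒ Δ →
          ⊢GT (χ ⟨ φL ⩖ φR ⟩) ∷ Γ ⇒ Δ
  R⩖ₗ   : ∀ {Γ Δ φL φR} (χ : Ctx) →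
          ⊢GT Γ ⇒ (χ ⟨ φL ⟩) ∷ Δ → ⊢GT Γ ⇒ (χ ⟨ φL ⩖ φR ⟩) ∷ Δ
  R⩖ᵣ   : ∀ {Γ Δ φL φR} (χ : Ctx) →
          ⊢GT Γ ⇒ (χ ⟨ φR ⟩) ∷ Δ → ⊢GT Γ ⇒ (χ ⟨ φL ⩖ φR ⟩) ∷ Δ
  cut   : ∀ {Γ Δ Π Σ′} φ → ⊢GT Γ ⇒ φ ∷ Δ → ⊢GT φ ∷ Π ⇒ Σ′ →
          ⊢GT Π ++ Γ ⇒ Δ ++ Σ′

-- Every formula is downward closed and true in the empty team.  Classical
-- formulas are flat (t ⊨ α iff every valuation of t satisfies α), so they are
-- closed under unions, and by evaluating α in each valuation a team splits into
-- a part satisfying α and a part satisfying ¬α.  Finally ⩖ can be pulled out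
-- of any context that is not under a negation.  The side formulas Λ of R∧ and
-- L∨ must be classical because these rules glue the two premises along a
-- union of teams, which needs ⋁Λ to be closed under unions.
module Submission where

open import Defs
open import Data.Bool using (Bool; true; false; not; T) renaming (_∧_ to _&&_; _∨_ to _||_)
open import Data.Bool.Properties using (T-≡; T-∧; T-∨)
open import Data.Empty using (⊥-elim)
open import Data.List using (List; []; _∷_; _++_; map; foldr)
open import Data.List.Relation.Unary.All as All using (All; _∷_)
open import Data.List.Relation.Unary.All.Properties using (++⁻ˡ; ++⁻ʳ)
open import Data.List.Relation.Binary.Permutation.Propositional as ↭ using (_↭_; ↭-sym)
open import Data.List.Relation.Binary.Permutation.Propositional.Properties using (All-resp-↭)
open import Data.Product as Product using (_,_; proj₁; proj₂)
open import Data.Sum as Sum using (_⊎_; inj₁; inj₂; [_,_]′)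
open import Data.Unit using (tt)
open import Function using (id; _∘_)
open import Function.Bundles using (_⇔_; mk⇔; Equivalence)
open import Function.Construct.Composition using (_⇔-∘_)
open import Level using (lift; lower)
open import Relation.Binary.PropositionalEquality using (_≡_; refl; cong)
open import Relation.Nullary using (¬_)
open import Relation.Unary using (_⊆′_; _∪_; _∩_; ∅)

open Equivalence using (to; from)

≐∪-covers : ∀ {t s u} → t ≐ s ∪ u → t ⊆′ s ∪ u
≐∪-covers t≐s∪u v = t≐s∪u v .to

≐∪-⊇ˡ : ∀ {t s u} → t ≐ s ∪ u → s ⊆′ t
≐∪-⊇ˡ t≐s∪u v = t≐s∪u v .from ∘ inj₁

≐∪-⊇ʳ : ∀ {t s u} → t ≐ s ∪ u → u ⊆′ t
≐∪-⊇ʳ t≐s∪u v = t≐s∪u v .from ∘ inj₂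

≐∪-restrict : ∀ {t s u} → t ⊆′ s ∪ u → t ≐ (t ∩ s) ∪ (t ∩ u)
≐∪-restrict t⊆s∪u v = mk⇔ (λ tv → Sum.map (tv ,_) (tv ,_) (t⊆s∪u v tv)) [ proj₁ , proj₁ ]′

mutual
  ⊨-antitone : ∀ φ {s t} → s ⊆′ t → t ⊨ φ → s ⊨ φ
  ⊨-antitone (var p) s⊆t (lift h) = lift λ v → h v ∘ s⊆t v
  ⊨-antitone bot     s⊆t (lift h) = lift λ v → h v ∘ s⊆t v
  ⊨-antitone (neg α) s⊆t h        = λ v → h v ∘ s⊆t v
  ⊨-antitone (φ ∧ ψ) s⊆t (h , k)  = ⊨-antitone φ s⊆t h , ⊨-antitone ψ s⊆t k
  ⊨-antitone (φ ∨ ψ) s⊆t (_ , _ , h , k , split) =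
    ∨-intro φ ψ h k (λ v → ≐∪-covers split v ∘ s⊆t v)
  ⊨-antitone (φ ⩖ ψ) s⊆t = Sum.map (⊨-antitone φ s⊆t) (⊨-antitone ψ s⊆t)

  ∨-intro : ∀ φ ψ {t s u} → s ⊨ φ → u ⊨ ψ → t ⊆′ s ∪ u → t ⊨ (φ ∨ ψ)
  ∨-intro φ ψ h k t⊆s∪u =
    _ , _ , ⊨-antitone φ (λ _ → proj₂) h , ⊨-antitone ψ (λ _ → proj₂) k , ≐∪-restrict t⊆s∪u

∅⊨ : ∀ φ → ∅ ⊨ φ
∅⊨ (var p) = lift λ _ ()
∅⊨ bot     = lift λ _ ()
∅⊨ (neg α) = λ _ ()
∅⊨ (φ ∧ ψ) = ∅⊨ φ , ∅⊨ ψ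
∅⊨ (φ ∨ ψ) = ∨-intro φ ψ (∅⊨ φ) (∅⊨ ψ) λ _ ()
∅⊨ (φ ⩖ ψ) = inj₁ (∅⊨ φ)

∨-assoc : ∀ φ ψ χ {t} → t ⊨ (φ ∨ ψ ∨ χ) → t ⊨ ((φ ∨ ψ) ∨ χ)
∨-assoc φ ψ χ (_ , _ , h , (_ , _ , k , l , split₂) , split₁) =
  ∨-intro (φ ∨ ψ) χ (∨-intro φ ψ h k λ _ → id) l
    λ v → Sum.assocˡ ∘ Sum.map₂ (≐∪-covers split₂ v) ∘ ≐∪-covers split₁ v

∨-left-comm : ∀ φ ψ χ {t} → t ⊨ (φ ∨ ψ ∨ χ) → t ⊨ (ψ ∨ φ ∨ χ)
∨-left-comm φ ψ χ (_ , _ , h , (_ , _ , k , l , split₂) , split₁) =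
  ∨-intro ψ (φ ∨ χ) k (∨-intro φ χ h l λ _ → id)
    λ v → [ inj₂ ∘ inj₁ , Sum.map₂ inj₂ ∘ ≐∪-covers split₂ v ]′ ∘ ≐∪-covers split₁ v

⟨⟩-mono : ∀ χ {a b} → (∀ {t} → t ⊨ a → t ⊨ b) → ∀ {t} → t ⊨ (χ ⟨ a ⟩) → t ⊨ (χ ⟨ b ⟩)
⟨⟩-mono ∙        a⇒b = a⇒b
⟨⟩-mono (χ ∧ₗ φ) a⇒b = Product.map₁ (⟨⟩-mono χ a⇒b)
⟨⟩-mono (φ ∧ᵣ χ) a⇒b = Product.map₂ (⟨⟩-mono χ a⇒b)
⟨⟩-mono (χ ∨ₗ φ) a⇒b (s , u , h , k , split) = s , u , ⟨⟩-mono χ a⇒b h , k , split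
⟨⟩-mono (φ ∨ᵣ χ) a⇒b (s , u , h , k , split) = s , u , h , ⟨⟩-mono χ a⇒b k , split
⟨⟩-mono (χ ⩖ₗ φ) a⇒b = Sum.map₁ (⟨⟩-mono χ a⇒b)
⟨⟩-mono (φ ⩖ᵣ χ) a⇒b = Sum.map₂ (⟨⟩-mono χ a⇒b)

⟨⩖⟩-split : ∀ χ {a b t} → t ⊨ (χ ⟨ a ⩖ b ⟩) → t ⊨ (χ ⟨ a ⟩) ⊎ t ⊨ (χ ⟨ b ⟩)
⟨⩖⟩-split ∙ = id
⟨⩖⟩-split (χ ∧ₗ φ) (h , k) = Sum.map (_, k) (_, k) (⟨⩖⟩-split χ h)
⟨⩖⟩-split (φ ∧ᵣ χ) (h , k) = Sum.map (h ,_) (h ,_) (⟨⩖⟩-split χ k)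
⟨⩖⟩-split (χ ∨ₗ φ) (s , u , h , k , split) =
  Sum.map (λ h′ → s , u , h′ , k , split) (λ h′ → s , u , h′ , k , split) (⟨⩖⟩-split χ h)
⟨⩖⟩-split (φ ∨ᵣ χ) (s , u , h , k , split) =
  Sum.map (λ k′ → s , u , h , k′ , split) (λ k′ → s , u , h , k′ , split) (⟨⩖⟩-split χ k)
⟨⩖⟩-split (χ ⩖ₗ φ) (inj₁ h) = Sum.map inj₁ inj₁ (⟨⩖⟩-split χ h)
⟨⩖⟩-split (χ ⩖ₗ φ) (inj₂ k) = inj₁ (inj₂ k)
⟨⩖⟩-split (φ ⩖ᵣ χ) (inj₁ h) = inj₁ (inj₁ h)
⟨⩖⟩-split (φ ⩖ᵣ χ) (inj₂ k) = Sum.map inj₂ inj₂ (⟨⩖⟩-split χ k)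

eval : CForm → Valuation → Bool
eval (cvar p)   v = v p
eval cbot       v = false
eval (cneg α)   v = not (eval α v)
eval (cand α β) v = eval α v && eval β v
eval (cor α β)  v = eval α v || eval β v

‖_‖ : CForm → Team
‖ α ‖ v = T (eval α v)

T-not : ∀ b → T (not b) ⇔ (¬ T b)
T-not true  = mk⇔ (λ ()) (λ ¬⊤ → ¬⊤ tt)
T-not false = mk⇔ (λ _ ()) (λ _ → tt)

singleton-⊆′ : ∀ {v} {P : Team} → ⟦ v ⟧₁ ⊆′ P ⇔ P v
singleton-⊆′ = mk⇔ (λ h → h _ refl) (λ { Pv _ refl → Pv })

⊨c-flat : ∀ α {t} → t ⊨c α ⇔ t ⊆′ ‖ α ‖
⊨c-flat (cvar p) = mk⇔ (λ h v tv → T-≡ .from (lower h v tv)) (λ h → lift λ v tv → T-≡ .to (h v tv))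
⊨c-flat cbot     = mk⇔ lower lift
⊨c-flat (cneg α) = mk⇔
  (λ h v tv → T-not (eval α v) .from λ α-true → h v tv (⊨c-flat α .from (singleton-⊆′ .from α-true)))
  (λ h v tv ⊨α → T-not (eval α v) .to (h v tv) (singleton-⊆′ .to (⊨c-flat α .to ⊨α)))
⊨c-flat (cand α β) = mk⇔
  (λ (h , k) v tv → T-∧ .from (⊨c-flat α .to h v tv , ⊨c-flat β .to k v tv))
  (λ h → ⊨c-flat α .from (λ v → proj₁ ∘ T-∧ .to ∘ h v) , ⊨c-flat β .from (λ v → proj₂ ∘ T-∧ .to ∘ h v))
⊨c-flat (cor α β) = mk⇔
  (λ (_ , _ , h , k , split) v tv →
    T-∨ .from (Sum.map (⊨c-flat α .to h v) (⊨c-flat β .to k v) (≐∪-covers split v tv)))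
  (λ h → _ , _ , ⊨c-flat α .from (λ _ → proj₂) , ⊨c-flat β .from (λ _ → proj₂) ,
         ≐∪-restrict (λ v → T-∨ .to ∘ h v))

⊨⌜⌝⇔⊨c : ∀ α {t} → t ⊨ ⌜ α ⌝ ⇔ t ⊨c α
⊨⌜⌝⇔⊨c (cvar p)   = mk⇔ id id
⊨⌜⌝⇔⊨c cbot       = mk⇔ id id
⊨⌜⌝⇔⊨c (cneg α)   = mk⇔ id id
⊨⌜⌝⇔⊨c (cand α β) = mk⇔ (Product.map (⊨⌜⌝⇔⊨c α .to) (⊨⌜⌝⇔⊨c β .to))
                         (Product.map (⊨⌜⌝⇔⊨c α .from) (⊨⌜⌝⇔⊨c β .from))
⊨⌜⌝⇔⊨c (cor α β)  = mk⇔ (λ (s , u , h , k , split) → s , u , ⊨⌜⌝⇔⊨c α .to h , ⊨⌜⌝⇔⊨c β .to k , split)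
                         (λ (s , u , h , k , split) → s , u , ⊨⌜⌝⇔⊨c α .from h , ⊨⌜⌝⇔⊨c β .from k , split)

⌜⌝-flat : ∀ α {t} → t ⊨ ⌜ α ⌝ ⇔ t ⊆′ ‖ α ‖
⌜⌝-flat α = ⊨c-flat α ⇔-∘ ⊨⌜⌝⇔⊨c α

∪-Closed : Form → Set₁
∪-Closed φ = ∀ {t s u} → s ⊨ φ → u ⊨ φ → t ⊆′ s ∪ u → t ⊨ φ

⌜⌝-∪-closed : ∀ α → ∪-Closed ⌜ α ⌝
⌜⌝-∪-closed α h k t⊆s∪u =
  ⌜⌝-flat α .from λ v → [ ⌜⌝-flat α .to h v , ⌜⌝-flat α .to k v ]′ ∘ t⊆s∪u v

⋁ᶜ : List CForm → CForm
⋁ᶜ = foldr cor cbot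

⋁-map-⌜⌝ : ∀ Λ → ⋁ (map ⌜_⌝ Λ) ≡ ⌜ ⋁ᶜ Λ ⌝
⋁-map-⌜⌝ []      = refl
⋁-map-⌜⌝ (α ∷ Λ) = cong (⌜ α ⌝ ∨_) (⋁-map-⌜⌝ Λ)

⋁⌜⌝-∪-closed : ∀ Λ → ∪-Closed (⋁ (map ⌜_⌝ Λ))
⋁⌜⌝-∪-closed Λ rewrite ⋁-map-⌜⌝ Λ = ⌜⌝-∪-closed (⋁ᶜ Λ)

excluded-middle : ∀ α v → ‖ cneg α ‖ v ⊎ ‖ α ‖ v
excluded-middle α v with eval α v
... | true  = inj₂ tt
... | false = inj₁ tt

disjunctive-syllogism : ∀ α φ {t} → t ⊨ neg α → t ⊨ (⌜ α ⌝ ∨ φ) → t ⊨ φ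
disjunctive-syllogism α φ {t} ¬α (_ , u , h , k , split) = ⊨-antitone φ t⊆u k
  where
    t⊆u : t ⊆′ u
    t⊆u v tv with ≐∪-covers split v tv
    ... | inj₂ uv = uv
    ... | inj₁ sv = ⊥-elim (T-not (eval α v) .to (⊨c-flat (cneg α) .to ¬α v tv) (⌜⌝-flat α .to h v sv))

∧-∨-distrib : ∀ φ ψ {χ} → ∪-Closed χ → ∀ {t} → t ⊨ (φ ∨ χ) → t ⊨ (ψ ∨ χ) → t ⊨ ((φ ∧ ψ) ∨ χ)
∧-∨-distrib φ ψ {χ} χ-∪-closed {t} (s₁ , u₁ , h₁ , k₁ , split₁) (s₂ , u₂ , h₂ , k₂ , split₂) =
  ∨-intro (φ ∧ ψ) χ (⊨-antitone φ (λ _ → proj₁) h₁ , ⊨-antitone ψ (λ _ → proj₂) h₂)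
    (χ-∪-closed k₁ k₂ λ _ → id) cover
  where
    cover : t ⊆′ (s₁ ∩ s₂) ∪ (u₁ ∪ u₂)
    cover v tv with ≐∪-covers split₁ v tv | ≐∪-covers split₂ v tv
    ... | inj₁ s₁v | inj₁ s₂v = inj₁ (s₁v , s₂v)
    ... | inj₂ u₁v | _        = inj₂ (inj₁ u₁v)
    ... | inj₁ _   | inj₂ u₂v = inj₂ (inj₂ u₂v)

⋁-++ : ∀ A B {t s u} → s ⊨ ⋁ A → u ⊨ ⋁ B → t ⊆′ s ∪ u → t ⊨ ⋁ (A ++ B)
⋁-++ []      B (lift s⊆∅) k t⊆s∪u =
  ⊨-antitone (⋁ B) (λ v → [ ⊥-elim ∘ s⊆∅ v , id ]′ ∘ t⊆s∪u v) k
⋁-++ (φ ∷ A) B (_ , _ , h , k , split) l t⊆s∪u =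
  ∨-intro φ (⋁ (A ++ B)) h (⋁-++ A B k l λ _ → id)
    λ v → Sum.assocʳ ∘ Sum.map₁ (≐∪-covers split v) ∘ t⊆s∪u v

⋁-++⁺ˡ : ∀ A B {t} → t ⊨ ⋁ A → t ⊨ ⋁ (A ++ B)
⋁-++⁺ˡ A B h = ⋁-++ A B h (∅⊨ (⋁ B)) λ _ → inj₁

⋁-↭ : ∀ {Δ Δ′} → Δ ↭ Δ′ → ∀ {t} → t ⊨ ⋁ Δ → t ⊨ ⋁ Δ′
⋁-↭ ↭.refl             = id
⋁-↭ (↭.prep φ p)       = ⟨⟩-mono (φ ∨ᵣ ∙) (⋁-↭ p)
⋁-↭ (↭.swap {Δ} φ ψ p) = ⟨⟩-mono (ψ ∨ᵣ (φ ∨ᵣ ∙)) (⋁-↭ p) ∘ ∨-left-comm φ ψ (⋁ Δ)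
⋁-↭ (↭.trans p q)      = ⋁-↭ q ∘ ⋁-↭ p

_⊨*_ : Team → List Form → Set₁
t ⊨* Γ = All (t ⊨_) Γ

⊨*-antitone : ∀ {Γ s t} → s ⊆′ t → t ⊨* Γ → s ⊨* Γ
⊨*-antitone s⊆t = All.map λ {γ} → ⊨-antitone γ s⊆t

sound : ∀ {Γ Δ} → ⊢GT Γ ⇒ Δ → ∀ {t} → t ⊨* Γ → t ⊨ ⋁ Δ
sound (perm Γ↭Γ′ Δ↭Δ′ d) env = ⋁-↭ Δ↭Δ′ (sound d (All-resp-↭ (↭-sym Γ↭Γ′) env))
sound (ax {Δ = Δ} p) (h ∷ _) = ∨-intro (var p) (⋁ Δ) h (∅⊨ (⋁ Δ)) λ _ → inj₁
sound (ax⊥ {Δ = Δ}) (lift t⊆∅ ∷ _) = ⊨-antitone (⋁ Δ) t⊆∅ (∅⊨ (⋁ Δ))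
sound (L¬ {Δ = Δ} α d) (h ∷ env) = disjunctive-syllogism α (⋁ Δ) h (sound d env)
sound (R¬ {Δ = Δ} α d) {t} env =
  ∨-intro (neg α) (⋁ Δ) {s = ‖ cneg α ‖} {u = t ∩ ‖ α ‖}
    (⊨c-flat (cneg α) .from λ _ → id)
    (sound d (⌜⌝-flat α .from (λ _ → proj₂) ∷ ⊨*-antitone (λ _ → proj₁) env))
    λ v tv → Sum.map₂ (tv ,_) (excluded-middle α v)
sound (L∧ d) ((h , k) ∷ env) = sound d (h ∷ k ∷ env)
sound (R∧ {Δ = Δ} {φ} {ψ} Λ d₁ d₂) env =
  ⋁-++⁺ˡ ((φ ∧ ψ) ∷ map ⌜_⌝ Λ) Δ (∧-∨-distrib φ ψ (⋁⌜⌝-∪-closed Λ) (sound d₁ env) (sound d₂ env))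
sound (L∨ {Δ = Δ} Λ d₁ d₂) ((_ , _ , h , k , split) ∷ env) =
  ⋁-++⁺ˡ (map ⌜_⌝ Λ) Δ
    (⋁⌜⌝-∪-closed Λ (sound d₁ (h ∷ ⊨*-antitone (≐∪-⊇ˡ split) env))
                    (sound d₂ (k ∷ ⊨*-antitone (≐∪-⊇ʳ split) env))
                    (≐∪-covers split))
sound (R∨ {Δ = Δ} {φ} {ψ} d) env = ∨-assoc φ ψ (⋁ Δ) (sound d env)
sound (L⩖ χ d₁ d₂) (h ∷ env) =
  [ (λ h₁ → sound d₁ (h₁ ∷ env)) , (λ h₂ → sound d₂ (h₂ ∷ env)) ]′ (⟨⩖⟩-split χ h)
sound (R⩖ₗ {Δ = Δ} χ d) env = ⟨⟩-mono (χ ∨ₗ ⋁ Δ) inj₁ (sound d env)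
sound (R⩖ᵣ {Δ = Δ} χ d) env = ⟨⟩-mono (χ ∨ₗ ⋁ Δ) inj₂ (sound d env)
sound (cut {Δ = Δ} {Π = Π} {Σ′ = Σ′} φ d₁ d₂) env =
  let (_ , _ , h , k , split) = sound d₁ (++⁻ʳ Π env)
  in ⋁-++ Δ Σ′ k (sound d₂ (h ∷ ⊨*-antitone (≐∪-⊇ˡ split) (++⁻ˡ Π env)))
       λ v → Sum.swap ∘ ≐∪-covers split v

mainTheorem1 : ∀ (Γ Δ : List Form) → ⊢GT Γ ⇒ Δ → Γ ⊫ ⋁ Δ
mainTheorem1 Γ Δ d t ⊨Γ = sound d (All.tabulate λ {γ} → ⊨Γ γ)
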